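{- Let $S$ be an association scheme on a finite set $X$, and let $\Delta_S$ be the morphism from $S$ to $S\boxtimes S$ given by $\Delta_S(x)=(x,x)$ for $x\in X$ and $\Delta_S(s)=[s,s]$ for $s\in S$. Then $\Delta_S$ is admissible if and only if $S$ is thin.
   Context: An association scheme on a finite set $X$ is a partition $S$ of $X\times X$ into nonempty subsets such that $1_X=\{(x,x)\}\in S$; $s^*=\{(x,y):(y,x)\in s\}\in S$; and for $p,q,r\in S$ there is $a_{pq}^r\ge0$ with $|\{y:(x,y)\in p,(y,z)\in q\}|=a_{pq}^r$ whenever $(x,z)\in r$. $S$ is thin if $|\{y:(x,y)\in s\}|=1$ for all $x\in X$, $s\in S$. For schemes $S$ on $X$ and $T$ on $Y$, the direct product $S\boxtimes T$ is the scheme on $X\times Y$ whose elements are $[s,t]=\{((x_1,y_1),(x_2,y_2)):(x_1,x_2)\in s,(y_1,y_2)\in t\}$. A morphism from $S$ on $X$ to $T$ on $Y$ is a function $\phi:X\cup S\to Y\cup T$ with $\phi(X)\subseteq Y$, $\phi(S)\subseteq T$, $(\phi(x_1),\phi(x_2))\in\phi(s)$ whenever $(x_1,x_2)\in s$; it is admissible if whenever $(\phi(x),y)\in\phi(s)$ there is $x'\in X$ with $\phi(x')=y$ and $(x,x')\in s$. -}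

module Defs where

open import Data.Nat using (ℕ)
open import Data.Fin using (Fin; _≟_)
open import Data.List using (length; filter)
open import Data.List using () renaming (allFin to allFinL)
open import Data.Product using (Σ; ∃; _×_; _,_; ∃-syntax)
open import Relation.Binary.PropositionalEquality using (_≡_; refl)
open import Relation.Nullary using (Dec; ¬_; _×-dec_)
open import Relation.Unary using (Pred; Decidable)
open import Level using (0ℓ)

count : ∀ {n} (P : Pred (Fin n) 0ℓ) → Decidable P → ℕ
count {n} P P? = length (filter P? (allFinL n))

-- A "relational structure": a set X together with a set S of relation labels and
-- the partition of X × X into the classes  s = {(x,y) : rel x y ≡ s}.
record RelStr : Set₁ where
  field
    Pt  : Set
    Lab : Set
    rel : Pt → Pt → Lab
open RelStr public

record Scheme (n d : ℕ) : Set where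
  field
    R         : Fin n → Fin n → Fin d
    nonempty  : ∀ (s : Fin d) → ∃[ x ] ∃[ y ] R x y ≡ s
    one       : Fin d
    one-spec  : ∀ x y → (R x y ≡ one → x ≡ y) × (x ≡ y → R x y ≡ one)
    star      : Fin d → Fin d
    star-spec : ∀ s x y → (R x y ≡ s → R y x ≡ star s) × (R y x ≡ star s → R x y ≡ s)
    a         : Fin d → Fin d → Fin d → ℕ
    a-spec    : ∀ p q r x z → R x z ≡ r →
                count (λ y → (R x y ≡ p) × (R y z ≡ q))
                      (λ y → (R x y ≟ p) ×-dec (R y z ≟ q))
                ≡ a p q r

  str : RelStr
  str = record { Pt = Fin n ; Lab = Fin d ; rel = R }

Thin : ∀ {n d} → Scheme n d → Set
Thin {n} S = ∀ x s → count (λ y → Scheme.R S x y ≡ s) (λ y → Scheme.R S x y ≟ s) ≡ 1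

_⊠_ : RelStr → RelStr → RelStr
A ⊠ B = record
  { Pt  = Pt A × Pt B
  ; Lab = Lab A × Lab B
  ; rel = λ { (x₁ , y₁) (x₂ , y₂) → (rel A x₁ x₂ , rel B y₁ y₂) } }

-- A morphism φ : X ∪ S → Y ∪ T, split into its point part and relation part.
record Morphism (A B : RelStr) : Set where
  field
    onPt  : Pt A → Pt B
    onLab : Lab A → Lab B
    resp  : ∀ x₁ x₂ → rel B (onPt x₁) (onPt x₂) ≡ onLab (rel A x₁ x₂)

Admissible : ∀ {A B} → Morphism A B → Set
Admissible {A} {B} φ =
  ∀ (x : Pt A) (s : Lab A) (y : Pt B) →
    rel B (onPt x) y ≡ onLab s →
    ∃[ x' ] (onPt x' ≡ y × rel A x x' ≡ s)
  where open Morphism φ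

Δ : ∀ {n d} (S : Scheme n d) → Morphism (Scheme.str S) (Scheme.str S ⊠ Scheme.str S)
Δ S = record { onPt = λ x → (x , x) ; onLab = λ s → (s , s) ; resp = λ _ _ → refl }

module Submission where

-- Proof idea.  Call a scheme S deterministic if every relation s ∈ S is the
-- graph of a partial function: (x,y₁), (x,y₂) ∈ s implies y₁ = y₂.
--
--  * Admissibility of Δ_S says exactly this: an element (y₁,y₂) with
--    ((x,x),(y₁,y₂)) ∈ [s,s] must be a diagonal point (x',x'), i.e. y₁ = y₂.
--  * Thinness implies determinism, since an s-neighbourhood of size 1 cannot
--    contain two distinct points.
--  * Conversely, a deterministic scheme has s-neighbourhoods of size ≤ 1.  The
--    size of the s-neighbourhood of x is the valency a_{s s*}^{1}, which does
--    not depend on x; as s is nonempty some neighbourhood has size ≥ 1, so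
--    every neighbourhood has size exactly 1, i.e. S is thin.

open import Defs
open import Data.Nat using (ℕ; _≤_; z≤n; s≤s)
open import Data.Nat.Properties using (≤-antisym)
open import Data.Fin using (Fin; _≟_)
open import Data.List using (List; []; _∷_; length; filter; allFin)
open import Data.List.Properties using (filter-≐)
open import Data.List.Membership.Propositional using (_∈_)
open import Data.List.Membership.Propositional.Properties
  using (∈-allFin; ∈-filter⁺; ∈-filter⁻; ∈-length)
open import Data.List.Relation.Unary.Any using (here; there)
open import Data.List.Relation.Unary.AllPairs using (_∷_)
open import Data.List.Relation.Unary.All using (_∷_)
open import Data.List.Relation.Unary.Unique.Propositional using (Unique)
open import Data.List.Relation.Unary.Unique.Propositional.Properties
  using (allFin⁺) renaming (filter⁺ to Unique-filter⁺)
open import Data.Product using (_×_; _,_; proj₁; proj₂; ∃-syntax)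
open import Data.Empty using (⊥-elim)
open import Relation.Binary.PropositionalEquality using (_≡_; refl; sym; trans; cong; cong₂)
open import Relation.Unary using (Pred; Decidable; _≐_)
open import Level using (0ℓ)

module _ {A : Set} where

  length≤1 : ∀ {xs : List A} → Unique xs →
    (∀ {a b} → a ∈ xs → b ∈ xs → a ≡ b) → length xs ≤ 1
  length≤1 {[]}         _                 _    = z≤n
  length≤1 {_ ∷ []}     _                 _    = s≤s z≤n
  length≤1 {_ ∷ _ ∷ _} ((x≢y ∷ _) ∷ _) same = ⊥-elim (x≢y (same (here refl) (there (here refl))))

  length≡1⇒members-equal : ∀ {xs : List A} → length xs ≡ 1 →
    ∀ {a b} → a ∈ xs → b ∈ xs → a ≡ b
  length≡1⇒members-equal {_ ∷ []} refl (here refl) (here refl) = refl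

module _ {n : ℕ} {P : Pred (Fin n) 0ℓ} (P? : Decidable P) where

  count≡1⇒unique : count P P? ≡ 1 → ∀ {a b} → P a → P b → a ≡ b
  count≡1⇒unique c≡1 Pa Pb =
    length≡1⇒members-equal c≡1 (∈-filter⁺ P? (∈-allFin _) Pa) (∈-filter⁺ P? (∈-allFin _) Pb)

  unique⇒count≡1 : (∀ {a b} → P a → P b → a ≡ b) → ∀ {y} → P y → count P P? ≡ 1
  unique⇒count≡1 unique Py = ≤-antisym
    (length≤1 (Unique-filter⁺ P? (allFin⁺ n))
              (λ a∈ b∈ → unique (satisfies a∈) (satisfies b∈)))
    (∈-length (∈-filter⁺ P? (∈-allFin _) Py))
    where
    satisfies : ∀ {a} → a ∈ filter P? (allFin n) → P a
    satisfies a∈ = proj₂ (∈-filter⁻ P? {xs = allFin n} a∈)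

  count-≐ : ∀ {Q : Pred (Fin n) 0ℓ} (Q? : Decidable Q) → P ≐ Q → count P P? ≡ count Q Q?
  count-≐ Q? P≐Q = cong length (filter-≐ P? Q? P≐Q (allFin n))

module _ {n d : ℕ} (S : Scheme n d) where
  open Scheme S

  valency : Fin n → Fin d → ℕ
  valency x s = count (λ y → R x y ≡ s) (λ y → R x y ≟ s)

  -- The valency of s at x is the intersection number a_{s s*}^{1}: the
  -- condition (x,y) ∈ s already forces (y,x) ∈ s*.
  valency≡a : ∀ x s → valency x s ≡ a s (star s) one
  valency≡a x s = trans
    (count-≐ _ _ ((λ {y} xy∈s → xy∈s , proj₁ (star-spec s x y) xy∈s) , proj₁))
    (a-spec s (star s) one x x (proj₂ (one-spec x x) refl))

  valency-invariant : ∀ x x' s → valency x s ≡ valency x' s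
  valency-invariant x x' s = trans (valency≡a x s) (sym (valency≡a x' s))

  Deterministic : Set
  Deterministic = ∀ x s {y₁ y₂} → R x y₁ ≡ s → R x y₂ ≡ s → y₁ ≡ y₂

  admissible⇒deterministic : Admissible (Δ S) → Deterministic
  admissible⇒deterministic adm x s {y₁} {y₂} xy₁∈s xy₂∈s
    with adm x s (y₁ , y₂) (cong₂ _,_ xy₁∈s xy₂∈s)
  ... | _ , refl , _ = refl

  -- The witness x' for (y₁,y₂) is y₁ itself, because determinism gives y₁ = y₂.
  deterministic⇒admissible : Deterministic → Admissible (Δ S)
  deterministic⇒admissible det x s (y₁ , y₂) xy∈[s,s] =
    y₁ , cong (y₁ ,_) (det x s (cong proj₁ xy∈[s,s]) (cong proj₂ xy∈[s,s])) , cong proj₁ xy∈[s,s]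

  thin⇒deterministic : Thin S → Deterministic
  thin⇒deterministic thin x s = count≡1⇒unique (λ y → R x y ≟ s) (thin x s)

  -- Some neighbourhood of s is nonempty, hence has exactly one element, and by
  -- invariance of valencies so do all the others.
  deterministic⇒thin : Deterministic → Thin S
  deterministic⇒thin det x s with nonempty s
  ... | x₀ , y₀ , x₀y₀∈s = trans (valency-invariant x x₀ s)
                                 (unique⇒count≡1 (λ y → R x₀ y ≟ s) (det x₀ s) x₀y₀∈s)

lemma7p6 : ∀ {n d : ℕ} (S : Scheme n d) →
    (Admissible (Δ S) → Thin S) × (Thin S → Admissible (Δ S))
lemma7p6 S =
    (λ adm  → deterministic⇒thin S (admissible⇒deterministic S adm))
  , (λ thin → deterministic⇒admissible S (thin⇒deterministic S thin))
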